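{- There is a function $C_6(t,\epsilon)$ such that the following holds for all $t\in\mathbb{N}$ and $\epsilon\in(0,1)$: let $G$ be a connected balanced bipartite graph with parts $X,Y$ each of order $n$, with minimum degree $\delta(G)\geq 3C_6(t,\epsilon)$, and with no induced $S_{t,t}$. Then for any vertices $a,b$ in the same part of $G$ there is a vertex $c$ in that same part such that $|N(a)\setminus N(c)|\leq \epsilon|N(a)|$ and $|N(b)\setminus N(c)|\leq \epsilon|N(b)|$.
   Context: $S_{t,t}$ is the graph with vertex set $\{x,x_1,\dots,x_t,y,y_1,\dots,y_t\}$ and edge set $\{xy\}\cup\{xy_1,\dots,xy_t\}\cup\{yx_1,\dots,yx_t\}$. $N(v)$ denotes the neighbourhood of $v$.
   Formalization: The parameter ε ranges over the rationals in (0,1), so the function $C_6(t,\epsilon)$ is defined on pairs of a natural number and a rational. -}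

module Defs where

open import Data.Nat using (ℕ)
open import Data.Bool using (Bool; true; false; _∧_; not; T)
open import Data.Fin using (Fin)
open import Data.Vec using (allFin; countᵇ)
open import Data.Sum using (_⊎_; inj₁; inj₂)
open import Data.Product using (_×_)
open import Data.Empty using (⊥)
open import Data.Unit using (⊤)
open import Data.Integer using (+_)
open import Data.Rational using (ℚ; _/_)
open import Function.Definitions using (Injective)
open import Relation.Binary.PropositionalEquality using (_≡_)

-- A bipartite graph with parts X = Fin n and Y = Fin n (balanced),
-- given by its (decidable) bipartite adjacency: adj x y = true iff xy ∈ E(G).
record BipGraph (n : ℕ) : Set where
  field
    adj : Fin n → Fin n → Bool
open BipGraph public

Vtx : ℕ → Set
Vtx n = Fin n ⊎ Fin n

Adj : ∀ {n} → BipGraph n → Vtx n → Vtx n → Set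
Adj G (inj₁ x) (inj₂ y) = T (adj G x y)
Adj G (inj₂ y) (inj₁ x) = T (adj G x y)
Adj G (inj₁ _) (inj₁ _) = ⊥
Adj G (inj₂ _) (inj₂ _) = ⊥

data Reach {n} (G : BipGraph n) : Vtx n → Vtx n → Set where
  here : ∀ {u} → Reach G u u
  step : ∀ {u v w} → Adj G u v → Reach G v w → Reach G u w

Connected : ∀ {n} → BipGraph n → Set
Connected G = ∀ u v → Reach G u v

nbr : ∀ {n} → BipGraph n → Vtx n → Fin n → Bool
nbr G (inj₁ x) y = adj G x y
nbr G (inj₂ y) x = adj G x y

deg : ∀ {n} → BipGraph n → Vtx n → ℕ
deg {n} G v = countᵇ (nbr G v) (allFin n)

-- |N(a) \ N(c)|  (only used for a, c in the same part)
diffSize : ∀ {n} → BipGraph n → Vtx n → Vtx n → ℕ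
diffSize {n} G a c = countᵇ (λ w → nbr G a w ∧ not (nbr G c w)) (allFin n)

SamePart : ∀ {n} → Vtx n → Vtx n → Set
SamePart (inj₁ _) (inj₁ _) = ⊤
SamePart (inj₂ _) (inj₂ _) = ⊤
SamePart _ _ = ⊥

data SVtx (t : ℕ) : Set where
  sx sy : SVtx t
  sxi syi : Fin t → SVtx t

SAdj : ∀ {t} → SVtx t → SVtx t → Set
SAdj sx sy = ⊤
SAdj sy sx = ⊤
SAdj sx (syi _) = ⊤
SAdj (syi _) sx = ⊤
SAdj sy (sxi _) = ⊤
SAdj (sxi _) sy = ⊤
SAdj _ _ = ⊥

record InducedS {n} (G : BipGraph n) (t : ℕ) : Set where
  field
    f   : SVtx t → Vtx n
    inj : Injective _≡_ _≡_ f
    pres : ∀ u w → SAdj u w → Adj G (f u) (f w)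
    refl′ : ∀ u w → Adj G (f u) (f w) → SAdj u w

ℕtoℚ : ℕ → ℚ
ℕtoℚ k = (+ k) / 1

module Submission where

-- Call c k-close to a set S on the other side if c misses at most |S|/k vertices of S.
-- Key lemma: if xy is an edge and S ⊆ N(x) is large, fewer than K neighbours of y are far
-- from S.  Otherwise a greedy procedure, choosing at each step by averaging a vertex w of S
-- missed by at least a 1/k fraction of the far neighbours still alive, produces t vertices of
-- S ∖ {y} and t far neighbours of y with no edges between them; with x and y these span an
-- induced S_{t,t}.  As all degrees are large, this lets us choose close vertices inside
-- neighbourhoods and their common parts, which gives two facts about vertices of one part:
--   (i) along a walk a–y–m–y′–b there is c close to both N(a) and N(b), via a vertex p close
--       to N(a) and the triangle inequality |N(a)∖N(c)| ≤ |N(a)∖N(p)| + |N(a)∩N(p)∖N(c)|;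
--  (ii) vertices joined by a walk of length 6 are joined by one of length 4, because most of
--       the neighbourhood of the middle vertex shares neighbours with both ends.
-- By (ii) and connectivity any two vertices of a part are joined by a walk of length 4, and (i)
-- with k = 4q, q the denominator of ε (so 1/q ≤ ε), gives the vertex c.

open import Defs
open import Data.Nat using (ℕ; _≤_; _*_)
open import Data.Product using (Σ; ∃; _×_)
open import Data.Rational using (ℚ; 0ℚ; 1ℚ) renaming (_≤_ to _≤ℚ_; _<_ to _<ℚ_; _*_ to _*ℚ_)
open import Relation.Nullary using (¬_)

open import Data.Nat using (zero; suc; _+_; _<_; _<ᵇ_; _≡ᵇ_; z≤n; s≤s; NonZero)
open import Data.Nat.Properties hiding (_≟_)
open import Data.Nat.Tactic.RingSolver using (solve-∀)
open import Data.Bool using (Bool; true; false; _∧_; _∨_; not; T)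
open import Data.Bool.Properties using (∧-identityʳ; ∧-zeroʳ; ∧-comm; ∧-distribˡ-∨; ∨-zeroʳ; T-≡) renaming (_≟_ to _≟𝔹_)
open import Data.Unit using (tt)
open import Data.Empty using (⊥-elim)
open import Data.Fin using (Fin; zero; suc; _≟_; punchIn)
open import Data.Fin.Properties using (¬∀⟶∃¬; punchInᵢ≢i)
open import Data.Vec using (allFin; countᵇ; tabulate)
open import Data.Vec.Functional using (removeAt; _∷_)
open import Data.Product using (_,_; proj₁; proj₂; map; map₂)
open import Data.Sum using (inj₁; inj₂; swap)
open import Data.Sum.Properties using (inj₁-injective; inj₂-injective; swap-involutive)
open import Data.Rational using (↧ₙ_)
open import Function using (_∘_; flip)
open import Function.Bundles using (Equivalence)
open import Function.Definitions using (Injective)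
open import Relation.Nullary using (Dec; does)
open import Relation.Nullary.Decidable using (dec-true; dec-false; _→-dec_)
open import Relation.Binary.PropositionalEquality
open import Algebra.Properties.CommutativeSemigroup *-commutativeSemigroup using (x∙yz≈y∙xz)
open import Algebra.Properties.Semiring.Sum +-*-semiring
  using (sum; sum-cong-≗; sum-remove; sum-replicate-zero; ∑-distrib-+; ∑-comm; *-distribˡ-sum; *-distribʳ-sum)

private
  variable
    n : ℕ

-- Subsets of a part, as Boolean predicates

Subset : ℕ → Set
Subset n = Fin n → Bool

infix 4 _∈_ _∉_ _⊆_
infixr 7 _∩_
infixl 6 _∖_
infixr 5 _∪_

_∈_ _∉_ : Fin n → Subset n → Set
i ∈ P = P i ≡ true
i ∉ P = P i ≡ false

_⊆_ : Subset n → Subset n → Set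
P ⊆ Q = ∀ i → i ∈ P → i ∈ Q

_∩_ _∪_ _∖_ : Subset n → Subset n → Subset n
(P ∩ Q) i = P i ∧ Q i
(P ∪ Q) i = P i ∨ Q i
(P ∖ Q) i = P i ∧ not (Q i)

∅ : Subset n
∅ _ = false

⁅_⁆ : Fin n → Subset n
⁅ w ⁆ i = does (i ≟ w)

⊆-refl : {P : Subset n} → P ⊆ P
⊆-refl _ i∈P = i∈P

∈∩⁻ : ∀ {i} (P Q : Subset n) → i ∈ P ∩ Q → i ∈ P × i ∈ Q
∈∩⁻ {i = i} P Q i∈ with P i | Q i
... | true | true = refl , refl

∈∖⁻ : ∀ {i} (P Q : Subset n) → i ∈ P ∖ Q → i ∈ P × i ∉ Q
∈∖⁻ {i = i} P Q i∈ with P i | Q i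
... | true | false = refl , refl

∈⇒¬∉ : ∀ {i} (P : Subset n) → i ∈ P → ¬ i ∉ P
∈⇒¬∉ P i∈P i∉P with trans (sym i∈P) i∉P
... | ()

∈∖⁺ : ∀ {i} (P Q : Subset n) → i ∈ P → i ∉ Q → i ∈ P ∖ Q
∈∖⁺ P Q i∈P i∉Q rewrite i∈P | i∉Q = refl

∈∩⁺ : ∀ {i} (P Q : Subset n) → i ∈ P → i ∈ Q → i ∈ P ∩ Q
∈∩⁺ P Q i∈P i∈Q rewrite i∈P | i∈Q = refl

∩-monoˡ : {P Q : Subset n} (R : Subset n) → P ⊆ Q → P ∩ R ⊆ Q ∩ R
∩-monoˡ {P = P} {Q} R P⊆Q i i∈ with ∈∩⁻ P R i∈
... | i∈P , i∈R = ∈∩⁺ Q R (P⊆Q i i∈P) i∈R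

∩⊆ˡ : (P Q : Subset n) → P ∩ Q ⊆ P
∩⊆ˡ P Q i = proj₁ ∘ ∈∩⁻ P Q

∩⊆ʳ : (P Q : Subset n) → P ∩ Q ⊆ Q
∩⊆ʳ P Q i = proj₂ ∘ ∈∩⁻ P Q

∖⊆ : (P Q : Subset n) → P ∖ Q ⊆ P
∖⊆ P Q i = proj₁ ∘ ∈∖⁻ P Q

𝟙 : Bool → ℕ
𝟙 true  = 1
𝟙 false = 0

∣_∣ : Subset n → ℕ
∣ P ∣ = sum (𝟙 ∘ P)

countᵇ-allFin : (P : Subset n) → countᵇ P (allFin n) ≡ ∣ P ∣
countᵇ-allFin P = countᵇ-tabulate P (λ i → i)
  where
  countᵇ-tabulate : ∀ {m n} (P : Subset n) (f : Fin m → Fin n) → countᵇ P (tabulate f) ≡ ∣ P ∘ f ∣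
  countᵇ-tabulate {zero}  P f = refl
  countᵇ-tabulate {suc m} P f with P (f zero) | countᵇ-tabulate P (f ∘ suc)
  ... | true  | eq = cong suc eq
  ... | false | eq = eq

sum-mono-≤ : ∀ {f g : Fin n → ℕ} → (∀ i → f i ≤ g i) → sum f ≤ sum g
sum-mono-≤ {zero}  f≤g = z≤n
sum-mono-≤ {suc n} f≤g = +-mono-≤ (f≤g zero) (sum-mono-≤ (f≤g ∘ suc))

∣∣-cong : {P Q : Subset n} → (∀ i → P i ≡ Q i) → ∣ P ∣ ≡ ∣ Q ∣
∣∣-cong P≗Q = sum-cong-≗ (cong 𝟙 ∘ P≗Q)

⊆⇒∣∣≤ : {P Q : Subset n} → P ⊆ Q → ∣ P ∣ ≤ ∣ Q ∣
⊆⇒∣∣≤ {P = P} {Q} P⊆Q = sum-mono-≤ (λ i → 𝟙-mono (P⊆Q i))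
  where
  𝟙-mono : ∀ {a b} → (a ≡ true → b ≡ true) → 𝟙 a ≤ 𝟙 b
  𝟙-mono {false} _   = z≤n
  𝟙-mono {true}  a⇒b rewrite a⇒b refl = ≤-refl

∣∅∣≡0 : ∣ ∅ {n} ∣ ≡ 0
∣∅∣≡0 {n} = sum-replicate-zero n

∣P∣≡∣P∩Q∣+∣P∖Q∣ : (P Q : Subset n) → ∣ P ∣ ≡ ∣ P ∩ Q ∣ + ∣ P ∖ Q ∣
∣P∣≡∣P∩Q∣+∣P∖Q∣ P Q = trans (sum-cong-≗ (λ i → split (P i) (Q i))) (∑-distrib-+ (𝟙 ∘ (P ∩ Q)) (𝟙 ∘ (P ∖ Q)))
  where
  split : ∀ a b → 𝟙 a ≡ 𝟙 (a ∧ b) + 𝟙 (a ∧ not b)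
  split false _     = refl
  split true  true  = refl
  split true  false = refl

∣P∪Q∣≤∣P∣+∣Q∣ : (P Q : Subset n) → ∣ P ∪ Q ∣ ≤ ∣ P ∣ + ∣ Q ∣
∣P∪Q∣≤∣P∣+∣Q∣ P Q = ≤-trans (sum-mono-≤ (λ i → 𝟙-∨ (P i) (Q i))) (≤-reflexive (∑-distrib-+ (𝟙 ∘ P) (𝟙 ∘ Q)))
  where
  𝟙-∨ : ∀ a b → 𝟙 (a ∨ b) ≤ 𝟙 a + 𝟙 b
  𝟙-∨ false _ = ≤-refl
  𝟙-∨ true  _ = s≤s z≤n

∣P∖R∣≤∣P∖Q∣+∣P∩Q∖R∣ : (P Q R : Subset n) → ∣ P ∖ R ∣ ≤ ∣ P ∖ Q ∣ + ∣ P ∩ Q ∖ R ∣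
∣P∖R∣≤∣P∖Q∣+∣P∩Q∖R∣ P Q R = ≤-trans (⊆⇒∣∣≤ (λ i → via-Q (P i) (Q i) (R i))) (∣P∪Q∣≤∣P∣+∣Q∣ (P ∖ Q) (P ∩ Q ∖ R))
  where
  via-Q : ∀ p q r → p ∧ not r ≡ true → (p ∧ not q) ∨ ((p ∧ q) ∧ not r) ≡ true
  via-Q true false r _ = refl
  via-Q true true false _ = refl

∣P∣≡1+∣P∖w∣ : (P : Subset n) (w : Fin n) → w ∈ P → ∣ P ∣ ≡ suc ∣ P ∖ ⁅ w ⁆ ∣
∣P∣≡1+∣P∖w∣ {suc n} P w w∈P = begin
  ∣ P ∣                                  ≡⟨ sum-remove {i = w} (𝟙 ∘ P) ⟩
  𝟙 (P w) + sum (removeAt (𝟙 ∘ P) w)     ≡⟨ cong₂ _+_ (cong 𝟙 w∈P) (sum-cong-≗ (cong 𝟙 ∘ off-w)) ⟩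
  1 + sum (removeAt (𝟙 ∘ (P ∖ ⁅ w ⁆)) w) ≡⟨ cong suc (trans (sum-remove {i = w} (𝟙 ∘ (P ∖ ⁅ w ⁆))) w-removed) ⟨
  suc ∣ P ∖ ⁅ w ⁆ ∣                      ∎
  where
  open ≡-Reasoning
  off-w : ∀ j → P (punchIn w j) ≡ (P ∖ ⁅ w ⁆) (punchIn w j)
  off-w j rewrite dec-false (punchIn w j ≟ w) (punchInᵢ≢i w j) = sym (∧-identityʳ (P (punchIn w j)))
  w-removed : 𝟙 ((P ∖ ⁅ w ⁆) w) + sum (removeAt (𝟙 ∘ (P ∖ ⁅ w ⁆)) w) ≡ sum (removeAt (𝟙 ∘ (P ∖ ⁅ w ⁆)) w)
  w-removed rewrite dec-true (w ≟ w) refl | ∧-zeroʳ (P w) = refl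

∣P∣≤1+∣P∖w∣ : (P : Subset n) (w : Fin n) → ∣ P ∣ ≤ suc ∣ P ∖ ⁅ w ⁆ ∣
∣P∣≤1+∣P∖w∣ P w with P w in P-w
... | true  = ≤-reflexive (∣P∣≡1+∣P∖w∣ P w P-w)
... | false = m≤n⇒m≤1+n (⊆⇒∣∣≤ λ i i∈P → ∈∖⁺ P ⁅ w ⁆ i∈P (dec-false (i ≟ w) (λ { refl → ∈⇒¬∉ P i∈P P-w })))

∈∖⁅⁆⁻ : ∀ {i w} (P : Subset n) → i ∈ P ∖ ⁅ w ⁆ → i ∈ P × i ≢ w
∈∖⁅⁆⁻ {i = i} {w} P i∈ with ∈∖⁻ P ⁅ w ⁆ i∈
... | i∈P , i∉w = i∈P , λ { refl → ∈⇒¬∉ {i = i} ⁅ i ⁆ (dec-true (i ≟ i) refl) i∉w }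

nonempty : (P : Subset n) → 0 < ∣ P ∣ → ∃ λ i → i ∈ P
nonempty {suc n} P 0<∣P∣ with P zero in P₀
... | true  = zero , P₀
... | false = map suc (λ i∈ → i∈) (nonempty (P ∘ suc) 0<∣P∣)

∣Q∣<∣P∣⇒∃∈P∖Q : (P Q : Subset n) → ∣ Q ∣ < ∣ P ∣ → ∃ λ i → i ∈ P × i ∉ Q
∣Q∣<∣P∣⇒∃∈P∖Q P Q ∣Q∣<∣P∣ = map₂ (∈∖⁻ P Q) (nonempty (P ∖ Q) 0<∣P∖Q∣)
  where
  0<∣P∖Q∣ : 0 < ∣ P ∖ Q ∣
  0<∣P∖Q∣ = +-cancelˡ-< (∣ Q ∣) 0 (∣ P ∖ Q ∣) (begin-strict
    ∣ Q ∣ + 0               ≡⟨ +-identityʳ (∣ Q ∣) ⟩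
    ∣ Q ∣                   <⟨ ∣Q∣<∣P∣ ⟩
    ∣ P ∣                   ≡⟨ ∣P∣≡∣P∩Q∣+∣P∖Q∣ P Q ⟩
    ∣ P ∩ Q ∣ + ∣ P ∖ Q ∣   ≤⟨ +-monoˡ-≤ (∣ P ∖ Q ∣) (⊆⇒∣∣≤ (∩⊆ʳ P Q)) ⟩
    ∣ Q ∣ + ∣ P ∖ Q ∣       ∎)
    where open ≤-Reasoning

avoid : (P B : Subset n) → ∣ P ∩ B ∣ < ∣ P ∣ → ∃ λ c → c ∈ P × c ∉ B
avoid P B ∣P∩B∣<∣P∣ with ∣Q∣<∣P∣⇒∃∈P∖Q P (P ∩ B) ∣P∩B∣<∣P∣
... | c , c∈P , c∉P∩B = c , c∈P , trans (cong (_∧ B c) (sym c∈P)) c∉P∩B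

avoid-two : ∀ {K₁ K₂} (P B₁ B₂ : Subset n) → ∣ P ∩ B₁ ∣ < K₁ → ∣ P ∩ B₂ ∣ < K₂ → K₁ + K₂ ≤ ∣ P ∣ →
            ∃ λ c → c ∈ P × c ∉ B₁ × c ∉ B₂
avoid-two {K₁ = K₁} {K₂} P B₁ B₂ ∣P∩B₁∣<K₁ ∣P∩B₂∣<K₂ K₁+K₂≤∣P∣ =
  let c , c∈P , c∉B₁∪B₂ = avoid P (B₁ ∪ B₂) few-bad in c , c∈P , ∉∪⁻ (B₁ c) (B₂ c) c∉B₁∪B₂
  where
  few-bad : ∣ P ∩ (B₁ ∪ B₂) ∣ < ∣ P ∣
  few-bad = begin-strict
    ∣ P ∩ (B₁ ∪ B₂) ∣        ≡⟨ ∣∣-cong (λ i → ∧-distribˡ-∨ (P i) (B₁ i) (B₂ i)) ⟩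
    ∣ P ∩ B₁ ∪ P ∩ B₂ ∣      ≤⟨ ∣P∪Q∣≤∣P∣+∣Q∣ (P ∩ B₁) (P ∩ B₂) ⟩
    ∣ P ∩ B₁ ∣ + ∣ P ∩ B₂ ∣  <⟨ +-mono-< ∣P∩B₁∣<K₁ ∣P∩B₂∣<K₂ ⟩
    K₁ + K₂                  ≤⟨ K₁+K₂≤∣P∣ ⟩
    ∣ P ∣                    ∎
    where open ≤-Reasoning
  ∉∪⁻ : ∀ b₁ b₂ → b₁ ∨ b₂ ≡ false → b₁ ≡ false × b₂ ≡ false
  ∉∪⁻ false false _ = refl , refl

∷-injective : ∀ {m} {w : Fin n} {f : Fin m → Fin n} →
              Injective _≡_ _≡_ f → (∀ i → f i ≢ w) → Injective _≡_ _≡_ (w ∷ f)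
∷-injective f-inj f≢w {zero}  {zero}  _  = refl
∷-injective f-inj f≢w {zero}  {suc j} eq = ⊥-elim (f≢w j (sym eq))
∷-injective f-inj f≢w {suc i} {zero}  eq = ⊥-elim (f≢w i eq)
∷-injective f-inj f≢w {suc i} {suc j} eq = cong suc (f-inj eq)

embed : ∀ m (P : Subset n) → m ≤ ∣ P ∣ → Σ (Fin m → Fin n) λ f → Injective _≡_ _≡_ f × (∀ i → f i ∈ P)
embed zero    P _ = (λ ()) , (λ { {()} }) , (λ ())
embed (suc m) P m<∣P∣ with nonempty P (≤-trans (s≤s z≤n) m<∣P∣)
... | w , w∈P with embed m (P ∖ ⁅ w ⁆) (≤-pred (≤-trans m<∣P∣ (≤-reflexive (∣P∣≡1+∣P∖w∣ P w w∈P))))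
...   | f , f-inj , f∈ =
  w ∷ f , ∷-injective f-inj (proj₂ ∘ ∈∖⁅⁆⁻ P ∘ f∈) , λ { zero → w∈P ; (suc i) → proj₁ (∈∖⁅⁆⁻ P (f∈ i)) }

-- Double counting and averaging

𝟙-∧ : ∀ a b → 𝟙 (a ∧ b) ≡ 𝟙 a * 𝟙 b
𝟙-∧ false _ = refl
𝟙-∧ true  b = sym (+-identityʳ (𝟙 b))

𝟙*∣∣ : ∀ a (P : Subset n) → 𝟙 a * ∣ P ∣ ≡ sum (λ i → 𝟙 (a ∧ P i))
𝟙*∣∣ a P = trans (*-distribˡ-sum (𝟙 a) (𝟙 ∘ P)) (sum-cong-≗ (λ i → sym (𝟙-∧ a (P i))))

double-counting : ∀ {m} (R : Subset m) (S : Subset n) (B : Fin m → Fin n → Bool) →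
                  sum (λ c → 𝟙 (R c) * ∣ S ∩ B c ∣) ≡ sum (λ w → 𝟙 (S w) * ∣ R ∩ flip B w ∣)
double-counting R S B = begin
  sum (λ c → 𝟙 (R c) * ∣ S ∩ B c ∣)               ≡⟨ sum-cong-≗ (λ c → 𝟙*∣∣ (R c) (S ∩ B c)) ⟩
  sum (λ c → sum (λ w → 𝟙 (R c ∧ (S w ∧ B c w)))) ≡⟨ ∑-comm (λ c w → 𝟙 (R c ∧ (S w ∧ B c w))) ⟩
  sum (λ w → sum (λ c → 𝟙 (R c ∧ (S w ∧ B c w)))) ≡⟨ sum-cong-≗ (λ w → sum-cong-≗ (λ c → cong 𝟙 (reorder c w))) ⟩
  sum (λ w → sum (λ c → 𝟙 (S w ∧ (R c ∧ B c w)))) ≡⟨ sum-cong-≗ (λ w → 𝟙*∣∣ (S w) (R ∩ flip B w)) ⟨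
  sum (λ w → 𝟙 (S w) * ∣ R ∩ flip B w ∣)          ∎
  where
  open ≡-Reasoning
  reorder : ∀ c w → R c ∧ (S w ∧ B c w) ≡ S w ∧ (R c ∧ B c w)
  reorder c w with R c
  ... | false = sym (∧-zeroʳ (S w))
  ... | true  = refl

pigeonhole : (S : Subset n) (f : Fin n → ℕ) (m : ℕ) → 0 < ∣ S ∣ →
             ∣ S ∣ * m ≤ sum (λ w → 𝟙 (S w) * f w) → ∃ λ w → w ∈ S × m ≤ f w
pigeonhole {n} S f m 0<∣S∣ ∣S∣*m≤∑ with ¬∀⟶∃¬ n Small Small? ¬all-small
  where
  Small : Fin n → Set
  Small w = w ∈ S → f w < m
  Small? : ∀ w → Dec (Small w)
  Small? w = (S w ≟𝔹 true) →-dec (f w <? m)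
  small : ∀ w → Small w → 𝟙 (S w) * f w + 𝟙 (S w) ≤ 𝟙 (S w) * m
  small w sm with S w
  ... | false = z≤n
  ... | true  rewrite *-identityˡ (f w) | *-identityˡ m | +-comm (f w) 1 = sm refl
  ¬all-small : ¬ (∀ w → Small w)
  ¬all-small all-small = <-irrefl refl (begin-strict
    ∣ S ∣ * m                                        <⟨ m<m+n _ 0<∣S∣ ⟩
    ∣ S ∣ * m + ∣ S ∣                                ≤⟨ +-monoˡ-≤ (∣ S ∣) ∣S∣*m≤∑ ⟩
    sum (λ w → 𝟙 (S w) * f w) + ∣ S ∣                ≡⟨ ∑-distrib-+ (λ w → 𝟙 (S w) * f w) (𝟙 ∘ S) ⟨
    sum (λ w → 𝟙 (S w) * f w + 𝟙 (S w))              ≤⟨ sum-mono-≤ (λ w → small w (all-small w)) ⟩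
    sum (λ w → 𝟙 (S w) * m)                          ≡⟨ *-distribʳ-sum m (𝟙 ∘ S) ⟨
    ∣ S ∣ * m                                        ∎)
    where open ≤-Reasoning
... | w , ¬small with S w in w∈S
...   | true  = w , w∈S , ≮⇒≥ (λ fw<m → ¬small (λ _ → fw<m))
...   | false = ⊥-elim (¬small (λ ()))

half-≤ : ∀ {m n} → m + m ≤ n + n → m ≤ n
half-≤ m+m≤n+n = ≮⇒≥ λ n<m → <⇒≱ (+-mono-< n<m n<m) m+m≤n+n

ratio-doubling : ∀ k s m → suc s ≤ k * suc m → 2 * k ≤ suc s → s ≤ 2 * k * m
ratio-doubling k s m 1+s≤k[1+m] 2k≤1+s = +-cancelʳ-≤ (2 * k) s (2 * k * m) (begin
  s + 2 * k               ≤⟨ +-monoʳ-≤ s 2k≤1+s ⟩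
  s + suc s               ≤⟨ +-monoˡ-≤ (suc s) (n≤1+n s) ⟩
  suc s + suc s           ≤⟨ +-mono-≤ 1+s≤k[1+m] 1+s≤k[1+m] ⟩
  k * suc m + k * suc m   ≡⟨ distribute k m ⟩
  2 * k * m + 2 * k       ∎)
  where
  open ≤-Reasoning
  distribute : ∀ k m → k * suc m + k * suc m ≡ 2 * k * m + 2 * k
  distribute = solve-∀

-- The key lemma: few far neighbours

-- The sizes of S and R that allow j steps of `greedy` started at ratio k; the ratio doubles
-- at every step.
σ-bound : ℕ → ℕ → ℕ
σ-bound zero    k = 0
σ-bound (suc j) k = σ-bound j (2 * k) + 2 * k

ρ-bound : ℕ → ℕ → ℕ → ℕ
ρ-bound t zero    k = t
ρ-bound t (suc j) k = k * ρ-bound t j (2 * k)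

module Bipartite {n} (A : Fin n → Fin n → Bool) where

  Far : ℕ → Subset n → Subset n
  Far k S c = ∣ S ∣ <ᵇ k * ∣ S ∖ A c ∣

  Close : ℕ → Subset n → Fin n → Set
  Close k S c = k * ∣ S ∖ A c ∣ ≤ ∣ S ∣

  ∈Far⇒ : ∀ k {S c} → c ∈ Far k S → ∣ S ∣ < k * ∣ S ∖ A c ∣
  ∈Far⇒ k {S} {c} c∈Far = <ᵇ⇒< (∣ S ∣) _ (subst T (sym c∈Far) tt)

  ∉Far⇒Close : ∀ k {S c} → c ∉ Far k S → Close k S c
  ∉Far⇒Close k {S} {c} c∉Far = ≮⇒≥ (λ far → subst T c∉Far (<⇒<ᵇ far))

  Close⇒half : ∀ k {S c} → 2 ≤ k → Close k S c → ∣ S ∣ ≤ ∣ S ∩ A c ∣ + ∣ S ∩ A c ∣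
  Close⇒half k {S} {c} 2≤k close = begin
    ∣ S ∣             ≡⟨ ∣P∣≡∣P∩Q∣+∣P∖Q∣ S (A c) ⟩
    ∣ S ∩ A c ∣ + ∣ S ∖ A c ∣ ≤⟨ +-monoʳ-≤ (∣ S ∩ A c ∣) missed≤kept ⟩
    ∣ S ∩ A c ∣ + ∣ S ∩ A c ∣ ∎
    where
    open ≤-Reasoning
    missed≤kept : ∣ S ∖ A c ∣ ≤ ∣ S ∩ A c ∣
    missed≤kept = +-cancelʳ-≤ (∣ S ∖ A c ∣) _ _ (begin
      ∣ S ∖ A c ∣ + ∣ S ∖ A c ∣ ≡⟨ cong (∣ S ∖ A c ∣ +_) (+-identityʳ (∣ S ∖ A c ∣)) ⟨
      2 * ∣ S ∖ A c ∣           ≤⟨ *-monoˡ-≤ (∣ S ∖ A c ∣) 2≤k ⟩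
      k * ∣ S ∖ A c ∣           ≤⟨ close ⟩
      ∣ S ∣                     ≡⟨ ∣P∣≡∣P∩Q∣+∣P∖Q∣ S (A c) ⟩
      ∣ S ∩ A c ∣ + ∣ S ∖ A c ∣ ∎)

  Close-trans : ∀ k {S p c} → Close k S p → Close k (S ∩ A p) c → k * ∣ S ∖ A c ∣ ≤ ∣ S ∣ + ∣ S ∣
  Close-trans k {S} {p} {c} S≈p S∩p≈c = begin
    k * ∣ S ∖ A c ∣                                ≤⟨ *-monoʳ-≤ k (∣P∖R∣≤∣P∖Q∣+∣P∩Q∖R∣ S (A p) (A c)) ⟩
    k * (∣ S ∖ A p ∣ + ∣ S ∩ A p ∖ A c ∣)          ≡⟨ *-distribˡ-+ k (∣ S ∖ A p ∣) _ ⟩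
    k * ∣ S ∖ A p ∣ + k * ∣ S ∩ A p ∖ A c ∣        ≤⟨ +-mono-≤ S≈p S∩p≈c ⟩
    ∣ S ∣ + ∣ S ∩ A p ∣                            ≤⟨ +-monoʳ-≤ (∣ S ∣) (⊆⇒∣∣≤ (∩⊆ˡ S (A p))) ⟩
    ∣ S ∣ + ∣ S ∣                                  ∎
    where open ≤-Reasoning

  averaging : ∀ k (R S : Subset n) → 0 < ∣ S ∣ → (∀ c → c ∈ R → ∣ S ∣ ≤ k * ∣ S ∖ A c ∣) →
              ∃ λ w → w ∈ S × ∣ R ∣ ≤ k * ∣ R ∖ flip A w ∣
  averaging k R S 0<∣S∣ R-far = pigeonhole S (λ w → k * ∣ R ∖ flip A w ∣) (∣ R ∣) 0<∣S∣ (begin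
    ∣ S ∣ * ∣ R ∣                                 ≡⟨ *-comm (∣ S ∣) (∣ R ∣) ⟩
    ∣ R ∣ * ∣ S ∣                                 ≡⟨ *-distribʳ-sum (∣ S ∣) (𝟙 ∘ R) ⟩
    sum (λ c → 𝟙 (R c) * ∣ S ∣)                   ≤⟨ sum-mono-≤ R-far′ ⟩
    sum (λ c → k * (𝟙 (R c) * ∣ S ∖ A c ∣))       ≡⟨ *-distribˡ-sum k (λ c → 𝟙 (R c) * ∣ S ∖ A c ∣) ⟨
    k * sum (λ c → 𝟙 (R c) * ∣ S ∖ A c ∣)         ≡⟨ cong (k *_) (double-counting R S (λ c w → not (A c w))) ⟩
    k * sum (λ w → 𝟙 (S w) * ∣ R ∖ flip A w ∣)    ≡⟨ *-distribˡ-sum k (λ w → 𝟙 (S w) * ∣ R ∖ flip A w ∣) ⟩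
    sum (λ w → k * (𝟙 (S w) * ∣ R ∖ flip A w ∣))  ≡⟨ sum-cong-≗ (λ w → x∙yz≈y∙xz k (𝟙 (S w)) _) ⟩
    sum (λ w → 𝟙 (S w) * (k * ∣ R ∖ flip A w ∣))  ∎)
    where
    open ≤-Reasoning
    R-far′ : ∀ c → 𝟙 (R c) * ∣ S ∣ ≤ k * (𝟙 (R c) * ∣ S ∖ A c ∣)
    R-far′ c with R c in c∈R
    ... | false = z≤n
    ... | true  rewrite *-identityˡ (∣ S ∣) | *-identityˡ (∣ S ∖ A c ∣) = R-far c c∈R

  record DoubleStar (t : ℕ) : Set where
    field
      x y          : Fin n
      x-y          : y ∈ A x
      xs ys        : Fin t → Fin n
      xs-injective : Injective _≡_ _≡_ xs
      ys-injective : Injective _≡_ _≡_ ys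
      xs≢x         : ∀ i → xs i ≢ x
      ys≢y         : ∀ j → ys j ≢ y
      xs-y         : ∀ i → y ∈ A (xs i)
      x-ys         : ∀ j → ys j ∈ A x
      xs-ys        : ∀ i j → ys j ∉ A (xs i)

  record Avoiding (t j : ℕ) (R S : Subset n) : Set where
    field
      ws           : Fin j → Fin n
      ws-injective : Injective _≡_ _≡_ ws
      ws∈S         : ∀ i → ws i ∈ S
      R′           : Subset n
      R′⊆R         : R′ ⊆ R
      t≤∣R′∣       : t ≤ ∣ R′ ∣
      R′-ws        : ∀ c i → c ∈ R′ → ws i ∉ A c

  Avoiding-∷ : ∀ {t j R S w} → w ∈ S → Avoiding t j (R ∖ flip A w) (S ∖ ⁅ w ⁆) → Avoiding t (suc j) R S
  Avoiding-∷ {R = R} {S} {w} w∈S av = record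
    { ws           = w ∷ ws
    ; ws-injective = ∷-injective ws-injective (proj₂ ∘ ∈∖⁅⁆⁻ S ∘ ws∈S)
    ; ws∈S         = λ { zero → w∈S ; (suc i) → proj₁ (∈∖⁅⁆⁻ S (ws∈S i)) }
    ; R′           = R′
    ; R′⊆R         = λ c → proj₁ ∘ ∈∖⁻ R (flip A w) ∘ R′⊆R c
    ; t≤∣R′∣       = t≤∣R′∣
    ; R′-ws        = λ { c zero c∈R′ → proj₂ (∈∖⁻ R (flip A w) (R′⊆R c c∈R′)) ; c (suc i) → R′-ws c i }
    }
    where open Avoiding av

  greedy-step : ∀ {k R S w} → w ∈ S → (∀ c → c ∈ R → ∣ S ∣ ≤ k * ∣ S ∖ A c ∣) → 2 * k ≤ ∣ S ∣ →
                ∀ c → c ∈ R ∖ flip A w → ∣ S ∖ ⁅ w ⁆ ∣ ≤ 2 * k * ∣ S ∖ ⁅ w ⁆ ∖ A c ∣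
  greedy-step {k} {R} {S} {w} w∈S R-far 2k≤∣S∣ c c∈R∖w with ∈∖⁻ R (flip A w) c∈R∖w
  ... | c∈R , w∉Ac = ratio-doubling k (∣ S ∖ ⁅ w ⁆ ∣) (∣ S ∖ ⁅ w ⁆ ∖ A c ∣)
          (begin
            suc ∣ S ∖ ⁅ w ⁆ ∣               ≡⟨ ∣P∣≡1+∣P∖w∣ S w w∈S ⟨
            ∣ S ∣                           ≤⟨ R-far c c∈R ⟩
            k * ∣ S ∖ A c ∣                 ≡⟨ cong (k *_) (∣P∣≡1+∣P∖w∣ (S ∖ A c) w (∈∖⁺ S (A c) w∈S w∉Ac)) ⟩
            k * suc ∣ S ∖ A c ∖ ⁅ w ⁆ ∣     ≡⟨ cong (λ m → k * suc m) (∣∣-cong (λ i → ∖-comm (S i) (A c i) (⁅ w ⁆ i))) ⟩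
            k * suc ∣ S ∖ ⁅ w ⁆ ∖ A c ∣     ∎)
          (≤-trans 2k≤∣S∣ (≤-reflexive (∣P∣≡1+∣P∖w∣ S w w∈S)))
    where
    open ≤-Reasoning
    ∖-comm : ∀ a b c → (a ∧ not b) ∧ not c ≡ (a ∧ not c) ∧ not b
    ∖-comm false b c = refl
    ∖-comm true  b c = ∧-comm (not b) (not c)

  greedy : ∀ t j k .{{_ : NonZero k}} (R S : Subset n) → (∀ c → c ∈ R → ∣ S ∣ ≤ k * ∣ S ∖ A c ∣) →
           σ-bound j k ≤ ∣ S ∣ → ρ-bound t j k ≤ ∣ R ∣ → Avoiding t j R S
  greedy t zero k R S _ _ t≤∣R∣ = record
    { ws = λ () ; ws-injective = λ { {()} } ; ws∈S = λ ()
    ; R′ = R ; R′⊆R = λ _ c∈R → c∈R ; t≤∣R′∣ = t≤∣R∣ ; R′-ws = λ _ () }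
  greedy t (suc j) k@(suc _) R S R-far σ≤∣S∣ ρ≤∣R∣ =
    let w , w∈S , ∣R∣≤k∣R∖w∣ = averaging k R S (≤-trans (s≤s z≤n) 2k≤∣S∣) R-far
    in Avoiding-∷ w∈S (greedy t j (2 * k) (R ∖ flip A w) (S ∖ ⁅ w ⁆)
         (greedy-step w∈S R-far 2k≤∣S∣)
         (σ-bound-step w w∈S)
         (*-cancelˡ-≤ k (≤-trans ρ≤∣R∣ ∣R∣≤k∣R∖w∣)))
    where
    2k≤∣S∣ : 2 * k ≤ ∣ S ∣
    2k≤∣S∣ = ≤-trans (m≤n+m (2 * k) _) σ≤∣S∣
    σ-bound-step : ∀ w → w ∈ S → σ-bound j (2 * k) ≤ ∣ S ∖ ⁅ w ⁆ ∣
    σ-bound-step w w∈S = ≤-pred (begin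
      suc (σ-bound j (2 * k))  ≡⟨ +-comm 1 _ ⟩
      σ-bound j (2 * k) + 1    ≤⟨ +-monoʳ-≤ (σ-bound j (2 * k)) (s≤s z≤n) ⟩
      σ-bound j (2 * k) + 2 * k ≤⟨ σ≤∣S∣ ⟩
      ∣ S ∣                    ≡⟨ ∣P∣≡1+∣P∖w∣ S w w∈S ⟩
      suc ∣ S ∖ ⁅ w ⁆ ∣        ∎)
      where open ≤-Reasoning

  ⊆⇒∉Far : ∀ k {S x} → S ⊆ A x → ¬ x ∈ Far k S
  ⊆⇒∉Far k {S} {x} S⊆Ax x∈Far = n≮0 (begin-strict
    ∣ S ∣            <⟨ ∈Far⇒ k {S} {x} x∈Far ⟩
    k * ∣ S ∖ A x ∣  ≤⟨ *-monoʳ-≤ k (⊆⇒∣∣≤ S∖Ax⊆∅) ⟩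
    k * ∣ ∅ {n} ∣    ≡⟨ cong (k *_) (∣∅∣≡0 {n}) ⟩
    k * 0            ≡⟨ *-zeroʳ k ⟩
    0                ∎)
    where
    open ≤-Reasoning
    S∖Ax⊆∅ : S ∖ A x ⊆ ∅
    S∖Ax⊆∅ i i∈ with ∈∖⁻ S (A x) i∈
    ... | i∈S , i∉Ax = ⊥-elim (∈⇒¬∉ (A x) (S⊆Ax i i∈S) i∉Ax)

  Avoiding⇒DoubleStar : ∀ {t k x y} (S : Subset n) → y ∈ A x → S ⊆ A x →
                        Avoiding t t (flip A y ∩ Far k S) (S ∖ ⁅ y ⁆) → DoubleStar t
  Avoiding⇒DoubleStar {t} {k} {x} {y} S x-y S⊆Ax av = record
    { x = x ; y = y ; x-y = x-y
    ; xs = xs ; ys = ws ; xs-injective = xs-injective ; ys-injective = ws-injective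
    ; xs≢x  = λ i xs-i≡x → ⊆⇒∉Far k S⊆Ax (subst (_∈ Far k S) xs-i≡x (∩⊆ʳ (flip A y) (Far k S) (xs i) (xs∈R i)))
    ; ys≢y  = λ j → proj₂ (∈∖⁅⁆⁻ S (ws∈S j))
    ; xs-y  = λ i → ∩⊆ˡ (flip A y) (Far k S) (xs i) (xs∈R i)
    ; x-ys  = λ j → S⊆Ax (ws j) (proj₁ (∈∖⁅⁆⁻ S (ws∈S j)))
    ; xs-ys = λ i j → R′-ws (xs i) j (xs∈R′ i)
    }
    where
    open Avoiding av
    xs : Fin t → Fin n
    xs = proj₁ (embed t R′ t≤∣R′∣)
    xs-injective : Injective _≡_ _≡_ xs
    xs-injective = proj₁ (proj₂ (embed t R′ t≤∣R′∣))
    xs∈R′ : ∀ i → xs i ∈ R′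
    xs∈R′ = proj₂ (proj₂ (embed t R′ t≤∣R′∣))
    xs∈R : ∀ i → xs i ∈ flip A y ∩ Far k S
    xs∈R i = R′⊆R (xs i) (xs∈R′ i)

  few-far : ∀ t → ¬ DoubleStar t → ∀ k .{{_ : NonZero k}} {x y} → y ∈ A x → (S : Subset n) → S ⊆ A x →
            σ-bound t k < ∣ S ∣ → ∣ flip A y ∩ Far k S ∣ < ρ-bound t t k
  few-far t no-star k {x} {y} x-y S S⊆Ax σ<∣S∣ = ≰⇒> λ ρ≤∣R∣ →
    no-star (Avoiding⇒DoubleStar {k = k} S x-y S⊆Ax (greedy t t k R S′ R-far σ≤∣S′∣ ρ≤∣R∣))
    where
    R S′ : Subset n
    R  = flip A y ∩ Far k S
    S′ = S ∖ ⁅ y ⁆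
    S∖Ac⊆S′∖Ac : ∀ c → y ∈ A c → S ∖ A c ⊆ S′ ∖ A c
    S∖Ac⊆S′∖Ac c c-y i i∈ with ∈∖⁻ S (A c) i∈
    ... | i∈S , i∉Ac = ∈∖⁺ S′ (A c) (∈∖⁺ S ⁅ y ⁆ i∈S (dec-false (i ≟ y) λ { refl → ∈⇒¬∉ (A c) c-y i∉Ac })) i∉Ac
    σ≤∣S′∣ : σ-bound t k ≤ ∣ S′ ∣
    σ≤∣S′∣ = ≤-pred (≤-trans σ<∣S∣ (∣P∣≤1+∣P∖w∣ S y))
    R-far : ∀ c → c ∈ R → ∣ S′ ∣ ≤ k * ∣ S′ ∖ A c ∣
    R-far c c∈R with ∈∩⁻ (flip A y) (Far k S) c∈R
    ... | c-y , c∈Far = ≤-trans (⊆⇒∣∣≤ (∖⊆ S ⁅ y ⁆))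
                          (<⇒≤ (<-≤-trans (∈Far⇒ k {S} {c} c∈Far) (*-monoʳ-≤ k (⊆⇒∣∣≤ (S∖Ac⊆S′∖Ac c c-y)))))

-- Graphs of large minimum degree without induced S_{t,t}

threshold : ℕ → ℕ → ℕ
threshold t q = 4 * ρ-bound t t (4 * q) + 2 * suc (σ-bound t (4 * q))

module Dense {n} (A : Fin n → Fin n → Bool) (t q : ℕ) .{{_ : NonZero q}}
             (no-star : ¬ Bipartite.DoubleStar A t)
             (deg-row : ∀ x → threshold t q ≤ ∣ A x ∣) (deg-col : ∀ y → threshold t q ≤ ∣ flip A y ∣) where

  open Bipartite A public

  k K σ : ℕ
  k = 4 * q
  K = ρ-bound t t k
  σ = suc (σ-bound t k)

  instance
    k-nonZero : NonZero k
    k-nonZero = m*n≢0 4 q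

  2≤k : 2 ≤ k
  2≤k = ≤-trans (s≤s (s≤s z≤n)) (m≤m*n 4 q)

  threshold-split : threshold t q ≡ (K + K) + (K + K) + (σ + σ)
  threshold-split = split K σ
    where
    split : ∀ K σ → 4 * K + 2 * σ ≡ (K + K) + (K + K) + (σ + σ)
    split = solve-∀

  4K≤ : ∀ {d} → threshold t q ≤ d → (K + K) + (K + K) ≤ d
  4K≤ D≤d = ≤-trans (m≤m+n _ (σ + σ)) (≤-trans (≤-reflexive (sym threshold-split)) D≤d)

  2K≤ : ∀ {d} → threshold t q ≤ d → K + K ≤ d
  2K≤ D≤d = ≤-trans (m≤m+n (K + K) _) (4K≤ D≤d)

  2σ≤ : ∀ {d} → threshold t q ≤ d → σ + σ ≤ d
  2σ≤ D≤d = ≤-trans (m≤n+m (σ + σ) _) (≤-trans (≤-reflexive (sym threshold-split)) D≤d)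

  σ≤ : ∀ {d} → threshold t q ≤ d → σ ≤ d
  σ≤ D≤d = ≤-trans (m≤m+n σ σ) (2σ≤ D≤d)

  few-far-neighbours : ∀ {x y} → y ∈ A x → (S : Subset n) → S ⊆ A x → σ ≤ ∣ S ∣ → ∣ flip A y ∩ Far k S ∣ < K
  few-far-neighbours = few-far t no-star k

  close-to-two : ∀ {x x′ y} (S S′ : Subset n) → y ∈ A x → y ∈ A x′ → S ⊆ A x → S′ ⊆ A x′ → σ ≤ ∣ S ∣ → σ ≤ ∣ S′ ∣ →
                 ∃ λ c → y ∈ A c × Close k S c × Close k S′ c
  close-to-two {y = y} S S′ x-y x′-y S⊆ S′⊆ σ≤∣S∣ σ≤∣S′∣ =
    let c , c-y , c∉Far , c∉Far′ = avoid-two (flip A y) (Far k S) (Far k S′)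
          (few-far-neighbours x-y S S⊆ σ≤∣S∣) (few-far-neighbours x′-y S′ S′⊆ σ≤∣S′∣) (2K≤ (deg-col y))
    in c , c-y , ∉Far⇒Close k c∉Far , ∉Far⇒Close k c∉Far′

  m₁+K+m₂+K≤d : ∀ {m₁ m₂ d} → k * m₁ ≤ d → k * m₂ ≤ d → threshold t q ≤ d → (m₁ + K) + (m₂ + K) ≤ d
  m₁+K+m₂+K≤d {m₁} {m₂} {d} km₁≤d km₂≤d D≤d = *-cancelˡ-≤ 4 (begin
    4 * ((m₁ + K) + (m₂ + K))               ≡⟨ expand m₁ m₂ K ⟩
    4 * m₁ + 4 * m₂ + ((K + K) + (K + K)) * 2 ≤⟨ +-mono-≤ (+-mono-≤ (4m≤d km₁≤d) (4m≤d km₂≤d)) (*-monoˡ-≤ 2 (4K≤ D≤d)) ⟩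
    d + d + d * 2                            ≡⟨ collect d ⟩
    4 * d                                    ∎)
    where
    open ≤-Reasoning
    expand : ∀ m₁ m₂ K → 4 * ((m₁ + K) + (m₂ + K)) ≡ 4 * m₁ + 4 * m₂ + ((K + K) + (K + K)) * 2
    expand = solve-∀
    collect : ∀ d → d + d + d * 2 ≡ 4 * d
    collect = solve-∀
    4m≤d : ∀ {m} → k * m ≤ d → 4 * m ≤ d
    4m≤d {m} km≤d = ≤-trans (*-monoˡ-≤ m (m≤m*n 4 q)) km≤d

module Rows {n} (A : Fin n → Fin n → Bool) (t q : ℕ) .{{_ : NonZero q}}
            (no-star : ¬ Bipartite.DoubleStar A t) (no-starᵀ : ¬ Bipartite.DoubleStar (flip A) t)
            (deg-row : ∀ x → threshold t q ≤ ∣ A x ∣) (deg-col : ∀ y → threshold t q ≤ ∣ flip A y ∣) where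

  module X = Dense A t q no-star deg-row deg-col
  module Y = Dense (flip A) t q no-starᵀ deg-col deg-row
  open X using (k; K; σ; 2≤k)

  σ≤∣common∣ : ∀ {a p} → X.Close k (A a) p → σ ≤ ∣ A a ∩ A p ∣
  σ≤∣common∣ {a} a≈p = half-≤ (≤-trans (X.2σ≤ (deg-row a)) (X.Close⇒half k 2≤k a≈p))

  close-common-neighbour : ∀ {a y z} → y ∈ A a → Y.Close k (flip A y) z →
                           ∃ λ p → p ∈ flip A y ∩ flip A z × X.Close k (A a) p
  close-common-neighbour {a} {y} {z} a-y y≈z =
    let p , p∈P , p∉Far = avoid P (X.Far k (A a)) few-far in p , p∈P , X.∉Far⇒Close k p∉Far
    where
    P : Subset n
    P = flip A y ∩ flip A z
    few-far : ∣ P ∩ X.Far k (A a) ∣ < ∣ P ∣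
    few-far = begin-strict
      ∣ P ∩ X.Far k (A a) ∣         ≤⟨ ⊆⇒∣∣≤ (∩-monoˡ (X.Far k (A a)) (∩⊆ˡ (flip A y) (flip A z))) ⟩
      ∣ flip A y ∩ X.Far k (A a) ∣  <⟨ X.few-far-neighbours a-y (A a) ⊆-refl (X.σ≤ (deg-row a)) ⟩
      K                             ≤⟨ half-≤ (≤-trans (X.2K≤ (deg-col y)) (Y.Close⇒half k 2≤k y≈z)) ⟩
      ∣ P ∣                         ∎
      where open ≤-Reasoning

  close-to-both : ∀ {a y m y′ b} → y ∈ A a → y ∈ A m → y′ ∈ A m → y′ ∈ A b →
                  ∃ λ c → k * ∣ A a ∖ A c ∣ ≤ ∣ A a ∣ + ∣ A a ∣ × k * ∣ A b ∖ A c ∣ ≤ ∣ A b ∣ + ∣ A b ∣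
  close-to-both {a} {y} {m} {y′} {b} a-y m-y m-y′ b-y′ =
    let z , _ , y≈z , y′≈z = Y.close-to-two (flip A y) (flip A y′) m-y m-y′ ⊆-refl ⊆-refl
                               (Y.σ≤ (deg-col y)) (Y.σ≤ (deg-col y′))
        p  , p∈  , a≈p  = close-common-neighbour a-y  y≈z
        p′ , p′∈ , b≈p′ = close-common-neighbour b-y′ y′≈z
        c , _ , a∩p≈c , b∩p′≈c = X.close-to-two (A a ∩ A p) (A b ∩ A p′)
                                   (proj₂ (∈∩⁻ (flip A y) (flip A z) p∈)) (proj₂ (∈∩⁻ (flip A y′) (flip A z) p′∈))
                                   (∩⊆ʳ (A a) (A p)) (∩⊆ʳ (A b) (A p′)) (σ≤∣common∣ a≈p) (σ≤∣common∣ b≈p′)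
    in c , X.Close-trans k a≈p a∩p≈c , X.Close-trans k b≈p′ b∩p′≈c

  CommonNeighbour : Fin n → Fin n → Set
  CommonNeighbour a b = ∃ λ r → r ∈ A a × r ∈ A b

  Apart : Fin n → Subset n
  Apart a c = ∣ A a ∩ A c ∣ ≡ᵇ 0

  ∉Apart⇒CommonNeighbour : ∀ {a c} → c ∉ Apart a → CommonNeighbour a c
  ∉Apart⇒CommonNeighbour {a} {c} c∉Apart =
    map₂ (∈∩⁻ (A a) (A c)) (nonempty (A a ∩ A c) (n≢0⇒n>0 λ eq → subst T c∉Apart (≡⇒≡ᵇ _ 0 eq)))

  close⇒¬Apart : ∀ {a p c} → X.Close k (A a) p → X.Close k (A a ∩ A p) c → c ∉ Apart a
  close⇒¬Apart {a} {p} {c} a≈p a∩p≈c = ∉Apart (≤-trans common⁺ (⊆⇒∣∣≤ (∩-monoˡ (A c) (∩⊆ˡ (A a) (A p)))))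
    where
    ∉Apart : 0 < ∣ A a ∩ A c ∣ → c ∉ Apart a
    ∉Apart 0<∣∣ with ∣ A a ∩ A c ∣
    ... | suc _ = refl
    common⁺ : 0 < ∣ (A a ∩ A p) ∩ A c ∣
    common⁺ with ∣ (A a ∩ A p) ∩ A c ∣ | X.Close⇒half k 2≤k a∩p≈c
    ... | zero  | ∣a∩p∣≤0 = ⊥-elim (n≮0 (≤-trans (σ≤∣common∣ a≈p) ∣a∩p∣≤0))
    ... | suc _ | _       = s≤s z≤n

  few-apart : ∀ {a y₀ u y} → y₀ ∈ A a → y₀ ∈ A u → y ∈ A u →
              ∃ λ z → Y.Close k (flip A y) z × ∣ flip A y ∩ Apart a ∣ < ∣ flip A y ∖ flip A z ∣ + K
  few-apart {a} {y₀} {u} {y} a-y₀ u-y₀ u-y =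
    let p , _ , a≈p , u≈p = X.close-to-two (A a) (A u) a-y₀ u-y₀ ⊆-refl ⊆-refl
                              (X.σ≤ (deg-row a)) (X.σ≤ (deg-row u))
        z , z∈ , z∉Far = avoid (A u ∩ A p) (Y.Far k (flip A y)) (few-far-columns p u≈p)
    in z , Y.∉Far⇒Close k z∉Far , apart-bound p z a≈p (proj₂ (∈∩⁻ (A u) (A p) z∈))
    where
    few-far-columns : ∀ p → X.Close k (A u) p → ∣ (A u ∩ A p) ∩ Y.Far k (flip A y) ∣ < ∣ A u ∩ A p ∣
    few-far-columns p u≈p = begin-strict
      ∣ (A u ∩ A p) ∩ Y.Far k (flip A y) ∣  ≤⟨ ⊆⇒∣∣≤ (∩-monoˡ (Y.Far k (flip A y)) (∩⊆ˡ (A u) (A p))) ⟩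
      ∣ A u ∩ Y.Far k (flip A y) ∣          <⟨ Y.few-far-neighbours u-y (flip A y) ⊆-refl (Y.σ≤ (deg-col y)) ⟩
      K                                     ≤⟨ half-≤ (≤-trans (X.2K≤ (deg-row u)) (X.Close⇒half k 2≤k u≈p)) ⟩
      ∣ A u ∩ A p ∣                         ∎
      where open ≤-Reasoning
    apart-bound : ∀ p z → X.Close k (A a) p → z ∈ A p → ∣ flip A y ∩ Apart a ∣ < ∣ flip A y ∖ flip A z ∣ + K
    apart-bound p z a≈p p-z = begin-strict
      ∣ flip A y ∩ Apart a ∣                              ≤⟨ ⊆⇒∣∣≤ apart⊆ ⟩
      ∣ flip A y ∖ flip A z ∪ flip A z ∩ X.Far k S ∣      ≤⟨ ∣P∪Q∣≤∣P∣+∣Q∣ (flip A y ∖ flip A z) (flip A z ∩ X.Far k S) ⟩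
      ∣ flip A y ∖ flip A z ∣ + ∣ flip A z ∩ X.Far k S ∣  <⟨ +-monoʳ-< (∣ flip A y ∖ flip A z ∣) few-far-from-S ⟩
      ∣ flip A y ∖ flip A z ∣ + K                         ∎
      where
      open ≤-Reasoning
      S : Subset n
      S = A a ∩ A p
      few-far-from-S : ∣ flip A z ∩ X.Far k S ∣ < K
      few-far-from-S = X.few-far-neighbours p-z S (∩⊆ʳ (A a) (A p)) (σ≤∣common∣ a≈p)
      -- A neighbour of z close to S meets S ⊆ N(a).
      apart⊆ : flip A y ∩ Apart a ⊆ flip A y ∖ flip A z ∪ flip A z ∩ X.Far k S
      apart⊆ c c∈ with ∈∩⁻ (flip A y) (Apart a) c∈ | A c z | X.Far k S c in c-far
      ... | c-y , _     | false | _     rewrite c-y = refl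
      ... | _   , _     | true  | true  = ∨-zeroʳ _
      ... | _   , c∈Apart | true  | false = ⊥-elim (∈⇒¬∉ (Apart a) c∈Apart (close⇒¬Apart a≈p (X.∉Far⇒Close k c-far)))

  Walk₄ : Fin n → Fin n → Set
  Walk₄ a b = ∃ λ m → CommonNeighbour a m × CommonNeighbour m b

  walk₄-refl : ∀ a → Walk₄ a a
  walk₄-refl a =
    let r , a-r = nonempty (A a) (≤-trans (s≤s z≤n) (X.σ≤ (deg-row a)))
    in a , (r , a-r , a-r) , (r , a-r , a-r)

  walk₄-join : ∀ {a y₀ u y b y₂ u′} → y₀ ∈ A a → y₀ ∈ A u → y ∈ A u → y₂ ∈ A b → y₂ ∈ A u′ → y ∈ A u′ → Walk₄ a b
  walk₄-join {a} {y = y} {b} a-y₀ u-y₀ u-y b-y₂ u′-y₂ u′-y =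
    let z  , y≈z  , few-a = few-apart a-y₀ u-y₀ u-y
        z′ , y≈z′ , few-b = few-apart b-y₂ u′-y₂ u′-y
        w , _ , w∉Apart-a , w∉Apart-b = avoid-two (flip A y) (Apart a) (Apart b) few-a few-b
                                          (X.m₁+K+m₂+K≤d y≈z y≈z′ (deg-col y))
        r′ , b-r′ , w-r′ = ∉Apart⇒CommonNeighbour w∉Apart-b
    in w , ∉Apart⇒CommonNeighbour w∉Apart-a , (r′ , w-r′ , b-r′)

  walk₄-extend : ∀ {u u′ r b} → r ∈ A u → r ∈ A u′ → Walk₄ u′ b → Walk₄ u b
  walk₄-extend u-r u′-r (m , (r₁ , u′-r₁ , m-r₁) , (r₂ , m-r₂ , b-r₂)) = walk₄-join u-r u′-r u′-r₁ b-r₂ m-r₂ m-r₁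

  walk₄⇒close : ∀ {a b} → Walk₄ a b → ∃ λ c → q * ∣ A a ∖ A c ∣ ≤ ∣ A a ∣ × q * ∣ A b ∖ A c ∣ ≤ ∣ A b ∣
  walk₄⇒close (m , (r , a-r , m-r) , (r′ , m-r′ , b-r′)) =
    let c , a≈c , b≈c = close-to-both a-r m-r m-r′ b-r′ in c , quarter a≈c , quarter b≈c
    where
    quarter : ∀ {x d} → 4 * q * x ≤ d + d → q * x ≤ d
    quarter {x} {d} 4qx≤2d = ≤-trans (m≤m+n (q * x) (q * x)) (half-≤ (≤-trans (≤-reflexive (regroup q x)) 4qx≤2d))
      where
      regroup : ∀ q x → (q * x + q * x) + (q * x + q * x) ≡ 4 * q * x
      regroup = solve-∀

-- Transposition and connectivity

transpose : BipGraph n → BipGraph n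
transpose G = record { adj = flip (adj G) }

module _ (G : BipGraph n) where

  Adj-transpose : ∀ u v → Adj (transpose G) u v → Adj G (swap u) (swap v)
  Adj-transpose (inj₁ _) (inj₂ _) uv = uv
  Adj-transpose (inj₂ _) (inj₁ _) uv = uv

  Adj-transpose⁻ : ∀ u v → Adj G u v → Adj (transpose G) (swap u) (swap v)
  Adj-transpose⁻ (inj₁ _) (inj₂ _) uv = uv
  Adj-transpose⁻ (inj₂ _) (inj₁ _) uv = uv

  Reach-transpose : ∀ {u v} → Reach G u v → Reach (transpose G) (swap u) (swap v)
  Reach-transpose here                     = here
  Reach-transpose (step {u} {v} uv v⇝w) = step (Adj-transpose⁻ u v uv) (Reach-transpose v⇝w)

  InducedS-transpose : ∀ {t} → InducedS (transpose G) t → InducedS G t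
  InducedS-transpose S = record
    { f     = swap ∘ f
    ; inj   = λ eq → inj (trans (sym (swap-involutive _)) (trans (cong swap eq) (swap-involutive _)))
    ; pres  = λ u w → Adj-transpose (f u) (f w) ∘ pres u w
    ; refl′ = λ u w → refl′ u w ∘ subst₂ (Adj (transpose G)) (swap-involutive (f u)) (swap-involutive (f w))
                                ∘ Adj-transpose⁻ (swap (f u)) (swap (f w))
    }
    where open InducedS S

  DoubleStar⇒InducedS : ∀ {t} → Bipartite.DoubleStar (adj G) t → InducedS G t
  DoubleStar⇒InducedS {t} S = record { f = f ; inj = λ {u} {w} → f-injective u w ; pres = pres ; refl′ = refl′ }
    where
    open Bipartite.DoubleStar S
    edge : ∀ {a b} → b ∈ adj G a → Adj G (inj₁ a) (inj₂ b)
    edge = Equivalence.from T-≡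
    f : SVtx t → Vtx n
    f sx      = inj₁ x
    f sy      = inj₂ y
    f (sxi i) = inj₁ (xs i)
    f (syi j) = inj₂ (ys j)
    f-injective : ∀ u w → f u ≡ f w → u ≡ w
    f-injective sx      sx       _  = refl
    f-injective sy      sy       _  = refl
    f-injective sx      (sxi i)  eq = ⊥-elim (xs≢x i (sym (inj₁-injective eq)))
    f-injective (sxi i) sx       eq = ⊥-elim (xs≢x i (inj₁-injective eq))
    f-injective sy      (syi j)  eq = ⊥-elim (ys≢y j (sym (inj₂-injective eq)))
    f-injective (syi j) sy       eq = ⊥-elim (ys≢y j (inj₂-injective eq))
    f-injective (sxi i) (sxi i′) eq = cong sxi (xs-injective (inj₁-injective eq))
    f-injective (syi j) (syi j′) eq = cong syi (ys-injective (inj₂-injective eq))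
    pres : ∀ u w → SAdj u w → Adj G (f u) (f w)
    pres sx      sy      _ = edge x-y
    pres sy      sx      _ = edge x-y
    pres sx      (syi j) _ = edge (x-ys j)
    pres (syi j) sx      _ = edge (x-ys j)
    pres sy      (sxi i) _ = edge (xs-y i)
    pres (sxi i) sy      _ = edge (xs-y i)
    refl′ : ∀ u w → Adj G (f u) (f w) → SAdj u w
    refl′ sx      sy      _  = tt
    refl′ sy      sx      _  = tt
    refl′ sx      (syi _) _  = tt
    refl′ (syi _) sx      _  = tt
    refl′ sy      (sxi _) _  = tt
    refl′ (sxi _) sy      _  = tt
    refl′ (sxi i) (syi j) uw = subst T (xs-ys i j) uw
    refl′ (syi j) (sxi i) uw = subst T (xs-ys i j) uw

module Connected-rows {n} (G : BipGraph n) (t q : ℕ) .{{_ : NonZero q}} (no-S : ¬ InducedS G t)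
                      (deg≥ : ∀ v → threshold t q ≤ deg G v) where

  open Rows (adj G) t q
    (no-S ∘ DoubleStar⇒InducedS G)
    (no-S ∘ InducedS-transpose G ∘ DoubleStar⇒InducedS (transpose G))
    (λ x → subst (threshold t q ≤_) (countᵇ-allFin (adj G x)) (deg≥ (inj₁ x)))
    (λ y → subst (threshold t q ≤_) (countᵇ-allFin (flip (adj G) y)) (deg≥ (inj₂ y)))

  LinkedTo : Fin n → Vtx n → Set
  LinkedTo b (inj₁ u) = Walk₄ u b
  LinkedTo b (inj₂ r) = ∃ λ u → r ∈ adj G u × Walk₄ u b

  Reach⇒LinkedTo : ∀ {v b} → Reach G v (inj₁ b) → LinkedTo b v
  Reach⇒LinkedTo {b = b} here = walk₄-refl b
  Reach⇒LinkedTo (step {inj₁ u} {inj₂ r} u-r r⇝b) =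
    let u′ , u′-r , u′⇝b = Reach⇒LinkedTo r⇝b in walk₄-extend (Equivalence.to T-≡ u-r) u′-r u′⇝b
  Reach⇒LinkedTo (step {inj₂ r} {inj₁ u} r-u u⇝b) = u , Equivalence.to T-≡ r-u , Reach⇒LinkedTo u⇝b

  close-to-connected-rows : ∀ a b → Reach G (inj₁ a) (inj₁ b) →
    ∃ λ c → q * diffSize G (inj₁ a) (inj₁ c) ≤ deg G (inj₁ a) × q * diffSize G (inj₁ b) (inj₁ c) ≤ deg G (inj₁ b)
  close-to-connected-rows a b a⇝b =
    let c , a≈c , b≈c = walk₄⇒close (Reach⇒LinkedTo a⇝b) in c , in-counts a c a≈c , in-counts b c b≈c
    where
    in-counts : ∀ x c → q * ∣ adj G x ∖ adj G c ∣ ≤ ∣ adj G x ∣ → q * diffSize G (inj₁ x) (inj₁ c) ≤ deg G (inj₁ x)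
    in-counts x c = subst₂ (λ d e → q * d ≤ e) (sym (countᵇ-allFin (adj G x ∖ adj G c))) (sym (countᵇ-allFin (adj G x)))

close-in-same-part : ∀ t q .{{_ : NonZero q}} (G : BipGraph n) → Connected G → (∀ v → threshold t q ≤ deg G v) →
                     ¬ InducedS G t → ∀ a b → SamePart a b →
                     ∃ λ c → SamePart a c × q * diffSize G a c ≤ deg G a × q * diffSize G b c ≤ deg G b
close-in-same-part t q G connected deg≥ no-S (inj₁ a) (inj₁ b) _ =
  let c , a≈c , b≈c = Connected-rows.close-to-connected-rows G t q no-S deg≥ a b (connected (inj₁ a) (inj₁ b))
  in inj₁ c , tt , a≈c , b≈c
close-in-same-part t q G connected deg≥ no-S (inj₂ a) (inj₂ b) _ =
  let c , a≈c , b≈c = Connected-rows.close-to-connected-rows (transpose G) t q (no-S ∘ InducedS-transpose G)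
                        (λ { (inj₁ y) → deg≥ (inj₂ y) ; (inj₂ x) → deg≥ (inj₁ x) }) a b
                        (Reach-transpose G (connected (inj₂ a) (inj₂ b)))
  in inj₂ c , tt , a≈c , b≈c

module _ where

  open import Data.Integer using (+_; +≤+; +<+; -[1+_]) renaming (_*_ to _*ℤ_; _≤_ to _≤ℤ_)
  open import Data.Integer.Properties using (pos-*)
  open import Data.Rational using (mkℚ; toℚᵘ)
  open import Data.Rational.Base using (*<*)
  open import Data.Rational.Properties using (toℚᵘ-cancel-≤; toℚᵘ-homo-*; toℚᵘ-fromℚᵘ)
  open import Data.Rational.Unnormalised using (mkℚᵘ; *≤*) renaming (_*_ to _*ᵘ_)
  import Data.Rational.Unnormalised.Properties as ℚᵘ

  ≤-den*⇒≤ℚ : ∀ ε → 0ℚ <ℚ ε → ∀ d e → ↧ₙ ε * d ≤ e → ℕtoℚ d ≤ℚ ε *ℚ ℕtoℚ e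
  -- ℕtoℚ d unfolds to fromℚᵘ (mkℚᵘ (+ d) 0).
  ≤-den*⇒≤ℚ ε@(mkℚ (+ suc p) q₀ _) _ d e qd≤e = toℚᵘ-cancel-≤ (begin
    toℚᵘ (ℕtoℚ d)            ≃⟨ toℚᵘ-fromℚᵘ (mkℚᵘ (+ d) 0) ⟩
    mkℚᵘ (+ d) 0             ≤⟨ *≤* (subst₂ _≤ℤ_ (pos-* d (suc q₀ * 1)) (pos-*-assoc (suc p) e) (+≤+ cross)) ⟩
    toℚᵘ ε *ᵘ mkℚᵘ (+ e) 0   ≃⟨ ℚᵘ.*-congˡ {toℚᵘ ε} (toℚᵘ-fromℚᵘ (mkℚᵘ (+ e) 0)) ⟨
    toℚᵘ ε *ᵘ toℚᵘ (ℕtoℚ e)  ≃⟨ toℚᵘ-homo-* ε (ℕtoℚ e) ⟨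
    toℚᵘ (ε *ℚ ℕtoℚ e)       ∎)
    where
    open ℚᵘ.≤-Reasoning
    pos-*-assoc : ∀ m n → + (m * n * 1) ≡ + m *ℤ + n *ℤ + 1
    pos-*-assoc m n = trans (pos-* (m * n) 1) (cong (_*ℤ + 1) (pos-* m n))
    cross : d * (suc q₀ * 1) ≤ suc p * e * 1
    cross rewrite *-identityʳ (suc q₀) | *-identityʳ (suc p * e) =
      ≤-trans (≤-reflexive (*-comm d (suc q₀))) (≤-trans qd≤e (m≤n*m e (suc p)))
  ≤-den*⇒≤ℚ (mkℚ (+ zero)   _ _) (*<* (+<+ ())) _ _ _
  ≤-den*⇒≤ℚ (mkℚ -[1+ _ ] _ _) (*<* ())        _ _ _

lemma2p4 : Σ (ℕ → ℚ → ℕ) λ C₆ →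
    ∀ (t : ℕ) (ε : ℚ) → 0ℚ <ℚ ε → ε <ℚ 1ℚ →
    ∀ (n : ℕ) (G : BipGraph n) → Connected G →
    (∀ v → 3 * C₆ t ε ≤ deg G v) →
    ¬ InducedS G t →
    ∀ (a b : Vtx n) → SamePart a b →
    ∃ λ c → SamePart a c
      × ℕtoℚ (diffSize G a c) ≤ℚ ε *ℚ ℕtoℚ (deg G a)
      × ℕtoℚ (diffSize G b c) ≤ℚ ε *ℚ ℕtoℚ (deg G b)
lemma2p4 = (λ t ε → threshold t (↧ₙ ε)) , λ t ε 0<ε _ n G connected 3C≤deg no-S a b a~b →
  let c , a~c , a≈c , b≈c = close-in-same-part t (↧ₙ ε) G connected (λ v → ≤-trans (m≤n*m _ 3) (3C≤deg v)) no-S a b a~b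
  in c , a~c , ≤-den*⇒≤ℚ ε 0<ε _ _ a≈c , ≤-den*⇒≤ℚ ε 0<ε _ _ b≈c
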